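{- Let $G$ be a connected graph with an interval colouring $c$, and suppose $G$ has an edge $e=vw$ that is the unique edge receiving colour $c_0=c(e)$, where $c_0$ is neither the minimum nor the maximum value taken by $c$. Then $V(G)$ can be partitioned as $V(G)=V_1\cup\{v,w\}\cup V_2$ such that every edge $f_1\in E(G)$ incident to some vertex of $V_1$ satisfies $c(f_1)<c_0$, and every edge $f_2\in E(G)$ incident to some vertex of $V_2$ satisfies $c(f_2)>c_0$. In particular, there are no edges between $V_1$ and $V_2$, and the restrictions of $c$ to $G[V_1\cup\{v,w\}]$ and to $G[V_2\cup\{v,w\}]$ are interval colourings.
   Context: An interval colouring of a graph $G=(V,E)$ is an edge-colouring $c\colon E\to\mathbb{Z}$ such that for every vertex $x$, the multiset of colours of edges incident to $x$ forms an interval of $\mathbb{Z}$. $G[S]$ denotes the subgraph induced on vertex set $S$. -}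

module Defs where

open import Data.Nat using (ℕ)
open import Data.Fin using (Fin)
open import Data.Integer using (ℤ; _≤_; _<_)
open import Data.Product using (_×_; ∃; ∃-syntax; _,_)
open import Data.Sum using (_⊎_)
open import Data.Unit using (⊤)
open import Relation.Nullary using (¬_)
open import Relation.Binary.PropositionalEquality using (_≡_)

record Graph (n : ℕ) : Set₁ where
  field
    Adj   : Fin n → Fin n → Set
    sym   : ∀ {x y} → Adj x y → Adj y x
    irrefl : ∀ {x} → ¬ Adj x x
open Graph public

data Reach {n : ℕ} (G : Graph n) : Fin n → Fin n → Set where
  here : ∀ {x} → Reach G x x
  step : ∀ {x y z} → Adj G x y → Reach G y z → Reach G x z

Connected : ∀ {n} → Graph n → Set
Connected G = ∀ x y → Reach G x y

-- An edge-colouring: the colour of edge xy is c x y; it must not depend on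
-- the orientation of the edge (values on non-edges are irrelevant).
IsEdgeColouring : ∀ {n} → Graph n → (Fin n → Fin n → ℤ) → Set
IsEdgeColouring G c = ∀ x y → Adj G x y → c x y ≡ c y x

-- The multiset of colours of edges of G[S] at x forms an interval of ℤ:
-- no colour repeats, and every integer between two occurring colours occurs.
IntervalAt : ∀ {n} → Graph n → (Fin n → Set) → (Fin n → Fin n → ℤ) → Fin n → Set
IntervalAt G S c x =
  (∀ y z → S y → S z → Adj G x y → Adj G x z → c x y ≡ c x z → y ≡ z)
  × (∀ y z (k : ℤ) → S y → S z → Adj G x y → Adj G x z →
       c x y ≤ k → k ≤ c x z → ∃[ u ] (S u × Adj G x u × c x u ≡ k))

IsIntervalColouringOn : ∀ {n} → Graph n → (Fin n → Set) → (Fin n → Fin n → ℤ) → Set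
IsIntervalColouringOn G S c =
  IsEdgeColouring G c × (∀ x → S x → IntervalAt G S c x)

IsIntervalColouring : ∀ {n} → Graph n → (Fin n → Fin n → ℤ) → Set
IsIntervalColouring G c = IsIntervalColouringOn G (λ _ → ⊤) c

-- Labels of a partition V(G) = V₁ ∪ {v,w} ∪ V₂.
data Part : Set where
  left mid right : Part

-- Only v and w see the colour c₀, and the colours at any vertex form an interval,
-- so at every other vertex all colours lie strictly on one side of c₀. Sorting the
-- vertices by that side gives V₁ and V₂. The edges inside V₁ ∪ {v, w} have colour
-- at most c₀ while every edge leaving it has colour above c₀, so gaps in an
-- interval at a vertex of V₁ ∪ {v, w} cannot be filled from outside; symmetrically
-- for V₂ ∪ {v, w}.
module Submission where

open import Defs
open import Data.Fin using (Fin; _≟_)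
open import Data.Integer using (ℤ; _<_; _≤_)
open import Data.Integer.Properties
  using (<-cmp; _≤?_; ≰⇒>; <⇒≤; ≤-reflexive; ≤-trans; <-irrefl; <-asym; ≤⇒≯)
open import Data.Product using (_×_; ∃; ∃-syntax; _,_; Σ; proj₁; proj₂)
open import Data.Sum using (_⊎_; inj₁; inj₂; [_,_])
open import Data.Unit using (tt)
open import Data.Empty using (⊥-elim)
open import Relation.Nullary using (¬_; yes; no)
open import Relation.Binary.Definitions using (tri<; tri≈; tri>)
open import Relation.Binary.PropositionalEquality using (_≡_; refl; subst) renaming (sym to ≡-sym)

reach-neighbour : ∀ {n} {G : Graph n} {x y} → Reach G x y → ¬ x ≡ y → ∃[ z ] Adj G x z
reach-neighbour here      x≢y = ⊥-elim (x≢y refl)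
reach-neighbour (step a _) _  = _ , a

restrict-interval :
  ∀ {n} (G : Graph n) (c : Fin n → Fin n → ℤ) → IsIntervalColouring G c →
  (S : Fin n → Set) (D : ℤ → Set) →
  (∀ {a k b} → a ≤ k → k ≤ b → D a → D b → D k) →
  (∀ {x z} → S x → S z → Adj G x z → D (c x z)) →
  (∀ {x u} → S x → Adj G x u → D (c x u) → S u) →
  IsIntervalColouringOn G S c
restrict-interval G c (colouring , interval) S D convex inside stays =
  colouring , λ x sx → (λ y z _ _ → proj₁ (interval x tt) y z tt tt) , fill x sx
  where
  fill : ∀ x → S x → ∀ y z (k : ℤ) → S y → S z → Adj G x y → Adj G x z →
         c x y ≤ k → k ≤ c x z → ∃[ u ] (S u × Adj G x u × c x u ≡ k)
  fill x sx y z k sy sz a b l g with proj₂ (interval x tt) y z k tt tt a b l g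
  ... | u , _ , au , cu =
    u , stays sx au (subst D (≡-sym cu) (convex l g (inside sx sy a) (inside sx sz b))) , au , cu

module Cut {n} (G : Graph n) (c : Fin n → Fin n → ℤ) (v w : Fin n)
  (connected : Connected G) (interval : IsIntervalColouring G c) (vw : Adj G v w)
  (unique : ∀ x y → Adj G x y → c x y ≡ c v w → (x ≡ v × y ≡ w) ⊎ (x ≡ w × y ≡ v))
  where

  c₀ : ℤ
  c₀ = c v w

  Endpoint : Fin n → Set
  Endpoint x = x ≡ v ⊎ x ≡ w

  adj-sym : ∀ {x y} → Adj G x y → Adj G y x
  adj-sym = Graph.sym G

  colour-sym : ∀ {x y} → Adj G x y → c x y ≡ c y x
  colour-sym {x} {y} = proj₁ interval x y

  sees-c₀⇒endpoint : ∀ {x y} → Adj G x y → c x y ≡ c₀ → Endpoint x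
  sees-c₀⇒endpoint {x} {y} a e with unique x y a e
  ... | inj₁ (x≡v , _) = inj₁ x≡v
  ... | inj₂ (x≡w , _) = inj₂ x≡w

  endpoint-sees-c₀ : ∀ {x} → Endpoint x → ∃[ y ] (Adj G x y × c x y ≡ c₀)
  endpoint-sees-c₀ (inj₁ refl) = w , vw , refl
  endpoint-sees-c₀ (inj₂ refl) = v , adj-sym vw , colour-sym (adj-sym vw)

  endpoints-edge : ∀ {x z} → Endpoint x → Endpoint z → Adj G x z → c x z ≡ c₀
  endpoints-edge (inj₁ refl) (inj₁ refl) a = ⊥-elim (irrefl G a)
  endpoints-edge (inj₁ refl) (inj₂ refl) a = refl
  endpoints-edge (inj₂ refl) (inj₁ refl) a = colour-sym a
  endpoints-edge (inj₂ refl) (inj₂ refl) a = ⊥-elim (irrefl G a)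

  straddle⇒endpoint : ∀ {x y z} → Adj G x y → Adj G x z →
                      c x y ≤ c₀ → c₀ ≤ c x z → Endpoint x
  straddle⇒endpoint {x} {y} {z} a b l g
    with proj₂ (proj₂ interval x tt) y z c₀ tt tt a b l g
  ... | _ , _ , au , cu = sees-c₀⇒endpoint au cu

  below-everywhere : ∀ {x y z} → ¬ Endpoint x → Adj G x y → c x y < c₀ →
                     Adj G x z → c x z < c₀
  below-everywhere {x} {z = z} ne a l b with c₀ ≤? c x z
  ... | yes g = ⊥-elim (ne (straddle⇒endpoint a b (<⇒≤ l) g))
  ... | no g̸ = ≰⇒> g̸

  above-everywhere : ∀ {x y z} → ¬ Endpoint x → Adj G x y → c₀ < c x y →
                     Adj G x z → c₀ < c x z
  above-everywhere {x} {z = z} ne a g b with c x z ≤? c₀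
  ... | yes l = ⊥-elim (ne (straddle⇒endpoint b a l (<⇒≤ g)))
  ... | no l̸ = ≰⇒> l̸

  data Position (x : Fin n) : Set where
    below    : (∀ {y} → Adj G x y → c x y < c₀) → Position x
    endpoint : Endpoint x → Position x
    above    : (∀ {y} → Adj G x y → c₀ < c x y) → Position x

  -- Adj is not decidable, so the neighbour whose colour decides the side of x
  -- is taken from a walk to v; this is the only use of connectivity.
  position : ∀ x → Position x
  position x with x ≟ v | x ≟ w
  ... | yes x≡v | _       = endpoint (inj₁ x≡v)
  ... | no _    | yes x≡w = endpoint (inj₂ x≡w)
  ... | no x≢v  | no x≢w  with reach-neighbour (connected x v) x≢v
  ... | y , a with <-cmp (c x y) c₀
  ... | tri< l _ _ = below (below-everywhere [ x≢v , x≢w ] a l)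
  ... | tri≈ _ e _ = endpoint (sees-c₀⇒endpoint a e)
  ... | tri> _ _ g = above (above-everywhere [ x≢v , x≢w ] a g)

  side : ∀ {x} → Position x → Part
  side (below _)    = left
  side (endpoint _) = mid
  side (above _)    = right

  label : Fin n → Part
  label x = side (position x)

  side-left : ∀ {x y} (p : Position x) → Adj G x y → side p ≡ left → c x y < c₀
  side-left (below h) a refl = h a

  side-right : ∀ {x y} (p : Position x) → Adj G x y → side p ≡ right → c₀ < c x y
  side-right (above h) a refl = h a

  side-mid : ∀ {x} (p : Position x) → side p ≡ mid → Endpoint x
  side-mid (endpoint e) refl = e

  side-endpoint : ∀ {x} (p : Position x) → Endpoint x → side p ≡ mid
  side-endpoint (endpoint _) _ = refl
  side-endpoint (below h) e with endpoint-sees-c₀ e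
  ... | _ , a , cy = ⊥-elim (<-irrefl cy (h a))
  side-endpoint (above h) e with endpoint-sees-c₀ e
  ... | _ , a , cy = ⊥-elim (<-irrefl (≡-sym cy) (h a))

  label-left : ∀ x y → Adj G x y → label x ≡ left → c x y < c₀
  label-left x _ = side-left (position x)

  label-right : ∀ x y → Adj G x y → label x ≡ right → c₀ < c x y
  label-right x _ = side-right (position x)

  label-mid : ∀ x → label x ≡ mid → Endpoint x
  label-mid x = side-mid (position x)

  label-endpoint : ∀ {x} → Endpoint x → label x ≡ mid
  label-endpoint {x} = side-endpoint (position x)

  label-right-sym : ∀ {x y} → Adj G x y → label y ≡ right → c₀ < c x y
  label-right-sym {x} {y} a ry = subst (c₀ <_) (colour-sym (adj-sym a)) (label-right y x (adj-sym a) ry)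

  label-left-sym : ∀ {x y} → Adj G x y → label y ≡ left → c x y < c₀
  label-left-sym {x} {y} a ly = subst (_< c₀) (colour-sym (adj-sym a)) (label-left y x (adj-sym a) ly)

  no-left-right-edge : ∀ x y → Adj G x y → label x ≡ left → ¬ label y ≡ right
  no-left-right-edge x y a lx ry = <-asym (label-left x y a lx) (label-right-sym a ry)

  Lower Upper : Fin n → Set
  Lower x = ¬ label x ≡ right
  Upper x = ¬ label x ≡ left

  inside-lower : ∀ {x z} → Lower x → Lower z → Adj G x z → c x z ≤ c₀
  inside-lower {x} {z} lx lz a with position x | position z
  ... | below h    | _          = <⇒≤ (h a)
  ... | _          | below h    = <⇒≤ (subst (_< c₀) (colour-sym (adj-sym a)) (h (adj-sym a)))
  ... | above _    | _          = ⊥-elim (lx refl)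
  ... | _          | above _    = ⊥-elim (lz refl)
  ... | endpoint e | endpoint f = ≤-reflexive (endpoints-edge e f a)

  inside-upper : ∀ {x z} → Upper x → Upper z → Adj G x z → c₀ ≤ c x z
  inside-upper {x} {z} ux uz a with position x | position z
  ... | above h    | _          = <⇒≤ (h a)
  ... | _          | above h    = <⇒≤ (subst (c₀ <_) (colour-sym (adj-sym a)) (h (adj-sym a)))
  ... | below _    | _          = ⊥-elim (ux refl)
  ... | _          | below _    = ⊥-elim (uz refl)
  ... | endpoint e | endpoint f = ≤-reflexive (≡-sym (endpoints-edge e f a))

  lower-interval : IsIntervalColouringOn G Lower c
  lower-interval = restrict-interval G c interval Lower (_≤ c₀)
    (λ _ k≤b _ b≤c₀ → ≤-trans k≤b b≤c₀) inside-lower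
    (λ _ a l ru → ≤⇒≯ l (label-right-sym a ru))

  upper-interval : IsIntervalColouringOn G Upper c
  upper-interval = restrict-interval G c interval Upper (c₀ ≤_)
    (λ a≤k _ c₀≤a _ → ≤-trans c₀≤a a≤k) inside-upper
    (λ _ a g lu → ≤⇒≯ g (label-left-sym a lu))

lemma4p2 : ∀ {n} (G : Graph n) (c : Fin n → Fin n → ℤ) (v w : Fin n) →
    Connected G → IsIntervalColouring G c → Adj G v w →
    (∀ x y → Adj G x y → c x y ≡ c v w → (x ≡ v × y ≡ w) ⊎ (x ≡ w × y ≡ v)) →
    (∃[ x ] ∃[ y ] (Adj G x y × c x y < c v w)) →
    (∃[ x ] ∃[ y ] (Adj G x y × c v w < c x y)) →
    Σ (Fin n → Part) λ ℓ → (
      (∀ x → ℓ x ≡ mid → x ≡ v ⊎ x ≡ w)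
      × ℓ v ≡ mid × ℓ w ≡ mid
      × (∀ x y → Adj G x y → ℓ x ≡ left → c x y < c v w)
      × (∀ x y → Adj G x y → ℓ x ≡ right → c v w < c x y)
      × (∀ x y → Adj G x y → ℓ x ≡ left → ¬ (ℓ y ≡ right))
      × IsIntervalColouringOn G (λ x → ¬ (ℓ x ≡ right)) c
      × IsIntervalColouringOn G (λ x → ¬ (ℓ x ≡ left)) c)
lemma4p2 G c v w connected interval vw unique _ _ =
  label , label-mid , label-endpoint (inj₁ refl) , label-endpoint (inj₂ refl)
  , label-left , label-right , no-left-right-edge , lower-interval , upper-interval
  where open Cut G c v w connected interval vw unique
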